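{- Let $J$ be an instance of TAP-AM with the master list $a_1,a_2,\dots,a_n$ of applicants. Then $J$ admits a unique stable matching, which may be found by Algorithm Serial Dictatorship.
   Context: TAP (the Teachers Assignment Problem): an instance consists of applicants, schools and subjects. Each applicant $a$ has a type ${\mathbf p}(a)=\{p_1,p_2\}$ of two distinct subjects and strictly ranks her acceptable schools $S(a)$. Each school $s$ has a partial capacity $c_p(s)$ for each subject $p$ and strictly ranks its applicants. A matching assigns each applicant to at most one acceptable school so that for each school $s$ and subject $p$ the number $|{\cal M}_p(s)|$ of assigned applicants whose type contains $p$ is at most $c_p(s)$. A pair $(a,s)$, $s\in S(a)$, blocks ${\cal M}$ if $a$ is unassigned or prefers $s$ to ${\cal M}(a)$ and: (i) $s$ is undersubscribed ($|{\cal M}_p(s)|<c_p(s)$) in both $p_1,p_2$; or (ii) $s$ is undersubscribed in $p_i$ and prefers $a$ to some applicant in ${\cal M}_{p_{3-i}}(s)$; or (iii) $s$ prefers $a$ to some assigned applicant of type exactly $\{p_1,p_2\}$; or (iv) $s$ prefers $a$ to two different applicants $a_1\in{\cal M}_{p_1}(s)$, $a_2\in{\cal M}_{p_2}(s)$. Stable means no blocking pair. TAP-AM is TAP in which every school's preference list is derived from a single common master list of applicants. Algorithm Serial Dictatorship: start with ${\cal M}=\emptyset$; for $i=1,\dots,n$ in master-list order, if $a_i$'s list contains a school with enough free capacity for $a_i$ (i.e., if $a_i$ has type $\{p,r\}$, $|{\cal M}_p(s)|<c_p(s)$ and $|{\cal M}_r(s)|<c_r(s)$), assign $a_i$ to the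 first such school on her list. -}

module Defs where

open import Data.Nat using (ℕ; _<_; _<?_)
open import Data.Fin as Fin using (Fin; _≟_)
open import Data.Fin.Properties as FinP using ()
open import Data.List using (List; []; _∷_; _++_; length; filter; allFin; foldl)
open import Data.List.Membership.Propositional using (_∈_)
open import Data.List.Relation.Unary.Unique.Propositional using (Unique)
open import Data.Maybe using (Maybe; just; nothing)
open import Data.Maybe.Properties using (≡-dec)
open import Data.Bool using (if_then_else_)
open import Data.Product using (Σ; _×_; _,_; ∃; ∃-syntax)
open import Data.Sum using (_⊎_)
open import Relation.Nullary using (¬_; Dec; yes; no; _×-dec_; _⊎-dec_)
open import Relation.Nullary.Decidable using (⌊_⌋)
open import Relation.Binary.PropositionalEquality using (_≡_; _≢_)

-- Applicants are Fin n, listed in MASTER-LIST ORDER: applicant i is a_{i+1},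
-- so the (common) school preference is: s prefers a to b  iff  a < b.
record TAP-AM (n m k : ℕ) : Set where
  field
    subj₁ subj₂ : Fin n → Fin k                    -- type p(a) = {subj₁ a, subj₂ a}
    distinct    : ∀ a → subj₁ a ≢ subj₂ a
    pref        : Fin n → List (Fin m)              -- S(a), best first
    prefUnique  : ∀ a → Unique (pref a)
    cap         : Fin m → Fin k → ℕ

module _ {n m k : ℕ} (J : TAP-AM n m k) where
  open TAP-AM J

  Assignment : Set
  Assignment = Fin n → Maybe (Fin m)

  HasSubj : Fin n → Fin k → Set
  HasSubj a p = p ≡ subj₁ a ⊎ p ≡ subj₂ a

  hasSubj? : ∀ a p → Dec (HasSubj a p)
  hasSubj? a p = (p ≟ subj₁ a) ⊎-dec (p ≟ subj₂ a)

  InMp : Assignment → Fin m → Fin k → Fin n → Set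
  InMp M s p b = M b ≡ just s × HasSubj b p

  inMp? : ∀ M s p b → Dec (InMp M s p b)
  inMp? M s p b = ≡-dec _≟_ (M b) (just s) ×-dec hasSubj? b p

  Mp : Assignment → Fin m → Fin k → List (Fin n)
  Mp M s p = filter (inMp? M s p) (allFin n)

  size : Assignment → Fin m → Fin k → ℕ
  size M s p = length (Mp M s p)

  Under : Assignment → Fin m → Fin k → Set
  Under M s p = size M s p < cap s p

  IsMatching : Assignment → Set
  IsMatching M = (∀ a s → M a ≡ just s → s ∈ pref a)
               × (∀ s p → size M s p Data.Nat.≤ cap s p)

  PrefersA : Fin n → Fin m → Fin m → Set
  PrefersA a s s' = ∃[ xs ] ∃[ ys ] (pref a ≡ xs ++ (s ∷ ys) × s' ∈ ys)

  PrefersS : Fin n → Fin n → Set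
  PrefersS a b = a Fin.< b

  Improves : Assignment → Fin n → Fin m → Set
  Improves M a s = M a ≡ nothing ⊎ ∃[ s' ] (M a ≡ just s' × PrefersA a s s')

  SameType : Fin n → Fin n → Set
  SameType a b = (subj₁ b ≡ subj₁ a × subj₂ b ≡ subj₂ a)
               ⊎ (subj₁ b ≡ subj₂ a × subj₂ b ≡ subj₁ a)

  Blocks : Assignment → Fin n → Fin m → Set
  Blocks M a s =
    s ∈ pref a × Improves M a s ×
    (
      (Under M s (subj₁ a) × Under M s (subj₂ a))
    ⊎ (Under M s (subj₁ a) × ∃[ b ] (InMp M s (subj₂ a) b × PrefersS a b))
    ⊎ (Under M s (subj₂ a) × ∃[ b ] (InMp M s (subj₁ a) b × PrefersS a b))
    ⊎ (∃[ b ] (M b ≡ just s × SameType a b × PrefersS a b))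
    ⊎ (∃[ b₁ ] ∃[ b₂ ] (b₁ ≢ b₂ × InMp M s (subj₁ a) b₁ × InMp M s (subj₂ a) b₂
                         × PrefersS a b₁ × PrefersS a b₂)))

  IsStable : Assignment → Set
  IsStable M = IsMatching M × (∀ a s → ¬ Blocks M a s)

  fits? : (M : Assignment) (a : Fin n) (s : Fin m) →
          Dec (Under M s (subj₁ a) × Under M s (subj₂ a))
  fits? M a s = (size M s (subj₁ a) <? cap s (subj₁ a))
          ×-dec (size M s (subj₂ a) <? cap s (subj₂ a))

  firstFit : Assignment → Fin n → List (Fin m) → Maybe (Fin m)
  firstFit M a []       = nothing
  firstFit M a (s ∷ ss) = if ⌊ fits? M a s ⌋ then just s else firstFit M a ss

  step : Assignment → Fin n → Assignment
  step M a b = if ⌊ b ≟ a ⌋ then firstFit M a (pref a) else M b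

  serialDictatorship : Assignment
  serialDictatorship = foldl step (λ _ → nothing) (allFin n)

-- Call M "greedy" when every applicant a gets the first school on her list
-- with room for her among the applicants before a in the master list, i.e.
-- M is a fixed point of the serial-dictatorship recursion.  Because schools
-- share the master list, a school has room for a in subject p in M
-- (a free seat, or an occupant ranked below a) exactly when it has a free
-- seat among a's predecessors; so (a, s) blocks M iff a prefers s to M(a) and
-- s fits a among her predecessors.  Hence a matching is stable iff it is
-- greedy, greedy assignments are matchings, and the recursion determines the
-- assignment applicant by applicant; serial dictatorship computes it.
module Submission where

open import Defs
open import Data.Nat as ℕ using (ℕ; zero; suc; _≤_; _<_; z≤n; s≤s)
import Data.Nat.Properties as ℕP
open import Data.Fin as Fin using (Fin; toℕ; _≟_)
import Data.Fin.Properties as FinP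
open import Data.List using (List; []; _∷_; _++_; length; filter; allFin; foldl; find)
open import Data.List.Properties using (filter-≐; filter-none)
open import Data.List.Membership.Propositional using (_∈_; _∉_)
open import Data.List.Membership.Propositional.Properties using (∈-allFin; ∈-++⁺ʳ; ∈-filter⁺; ∈-filter⁻)
open import Data.List.Relation.Unary.Any using (here; there)
open import Data.List.Relation.Unary.All as All using (All; []; _∷_)
open import Data.List.Relation.Unary.AllPairs using (AllPairs; []; _∷_)
open import Data.List.Relation.Unary.AllPairs.Properties using (tabulate⁺-<)
open import Data.List.Relation.Unary.Unique.Propositional using (Unique)
open import Data.List.Relation.Unary.Unique.Propositional.Properties using (allFin⁺)
open import Data.List.Relation.Binary.Equality.Propositional using (≋⇒≡)
import Data.List.Relation.Binary.Sublist.Propositional as Sublist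
import Data.List.Relation.Binary.Sublist.Propositional.Properties as Sublist
open import Data.Bool using (if_then_else_)
open import Data.Maybe using (just; nothing)
open import Data.Maybe.Properties using (just-injective)
open import Data.Product using (_×_; _,_; proj₁; proj₂; ∃-syntax)
open import Data.Sum using (_⊎_; inj₁; inj₂; map₂)
open import Data.Empty using (⊥-elim)
open import Function using (_∘_)
open import Relation.Nullary using (¬_; yes; no; contradiction; _×-dec_)
open import Relation.Nullary.Decidable using (isYes≗does)
open import Relation.Unary using (Pred; Decidable; _⊆_; _≐_)
open import Relation.Binary.PropositionalEquality
open import Relation.Binary.Definitions using (tri<; tri≈; tri>)

module _ {a} {A : Set a} where

  Before : List A → A → A → Set a
  Before xs x y = ∃[ ys ] ∃[ zs ] (xs ≡ ys ++ x ∷ zs × y ∈ zs)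

  Before-∷ : ∀ {z xs x y} → Before xs x y → Before (z ∷ xs) x y
  Before-∷ {z} (ys , zs , refl , y∈zs) = z ∷ ys , zs , refl , y∈zs

  Before⇒≢ : ∀ {xs x y} → Unique xs → Before xs x y → x ≢ y
  Before⇒≢ (x∉zs ∷ _) ([]     , zs , refl , y∈zs) = All.lookup x∉zs y∈zs
  Before⇒≢ (_ ∷ u)    (_ ∷ ys , zs , refl , y∈zs) = Before⇒≢ u (ys , zs , refl , y∈zs)

module _ {a p} {A : Set a} {P : Pred A p} (P? : Decidable P) where

  find-just⇒∈ : ∀ {xs x} → find P? xs ≡ just x → x ∈ xs
  find-just⇒∈ {y ∷ xs} found with P? y
  ... | yes _ = here (sym (just-injective found))
  ... | no  _ = there (find-just⇒∈ {xs} found)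

  find-just⇒P : ∀ {xs x} → find P? xs ≡ just x → P x
  find-just⇒P {y ∷ xs} found with P? y
  ... | yes py = subst P (just-injective found) py
  ... | no  _  = find-just⇒P {xs} found

  find-nothing⇒¬P : ∀ {xs x} → find P? xs ≡ nothing → x ∈ xs → ¬ P x
  find-nothing⇒¬P {y ∷ xs} found x∈ with P? y
  find-nothing⇒¬P {y ∷ xs} () x∈ | yes _
  find-nothing⇒¬P {y ∷ xs} found (here refl)  | no ¬py = ¬py
  find-nothing⇒¬P {y ∷ xs} found (there x∈xs) | no _   = find-nothing⇒¬P found x∈xs

  find-just⇒¬P-before : ∀ {xs x y} → Unique xs → find P? xs ≡ just x → Before xs y x → ¬ P y
  find-just⇒¬P-before {y ∷ zs} u found ([] , zs , refl , x∈zs) py with P? y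
  ... | yes _  = Before⇒≢ u ([] , zs , refl , x∈zs) (just-injective found)
  ... | no ¬py = ¬py py
  find-just⇒¬P-before (z∉ ∷ u) found (z ∷ ys , zs , refl , x∈zs) py with P? z
  ... | yes _ = All.lookup z∉ (∈-++⁺ʳ ys (there x∈zs)) (just-injective found)
  ... | no  _ = find-just⇒¬P-before u found (ys , zs , refl , x∈zs) py

  find-first : ∀ {xs y} → y ∈ xs → P y → ∃[ x ] (find P? xs ≡ just x × (x ≡ y ⊎ Before xs x y))
  find-first {z ∷ xs} y∈ py with P? z
  find-first {z ∷ xs} (here refl)  py | yes _  = z , refl , inj₁ refl
  find-first {z ∷ xs} (there y∈xs) py | yes _  = z , refl , inj₂ ([] , xs , refl , y∈xs)
  find-first {z ∷ xs} (here refl)  py | no ¬pz = contradiction py ¬pz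
  find-first {z ∷ xs} (there y∈xs) py | no _ with find-first y∈xs py
  ... | x , found , inj₁ x≡y    = x , found , inj₁ x≡y
  ... | x , found , inj₂ before = x , found , inj₂ (Before-∷ before)

module _ {a p q} {A : Set a} {P : Pred A p} {Q : Pred A q}
         (P? : Decidable P) (Q? : Decidable Q) where

  find-cong : P ≐ Q → ∀ xs → find P? xs ≡ find Q? xs
  find-cong P≐Q [] = refl
  find-cong P≐Q (x ∷ xs) with P? x | Q? x
  ... | yes _   | yes _  = refl
  ... | no  _   | no  _  = find-cong P≐Q xs
  ... | yes px  | no ¬qx = contradiction (proj₁ P≐Q px) ¬qx
  ... | no ¬px  | yes qx = contradiction (proj₂ P≐Q qx) ¬px

  length-filter-mono : ∀ xs → All (λ x → P x → Q x) xs →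
                       length (filter P? xs) ≤ length (filter Q? xs)
  length-filter-mono []       []               = z≤n
  length-filter-mono (x ∷ xs) (P⇒Q ∷ P⇒Q-xs) with P? x | Q? x
  ... | yes _  | yes _  = s≤s (length-filter-mono xs P⇒Q-xs)
  ... | yes px | no ¬qx = contradiction (P⇒Q px) ¬qx
  ... | no  _  | yes _  = ℕP.m≤n⇒m≤1+n (length-filter-mono xs P⇒Q-xs)
  ... | no  _  | no  _  = length-filter-mono xs P⇒Q-xs

  -- If the two filters had equal length, the sublist filter P? xs ⊆ filter Q? xs
  -- would be an equality, putting y into filter P? xs.
  length-filter-< : P ⊆ Q → ∀ {xs y} → y ∈ xs → Q y → ¬ P y →
                    length (filter P? xs) < length (filter Q? xs)
  length-filter-< P⊆Q {xs} {y} y∈xs qy ¬py =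
    ℕP.≤∧≢⇒< (Sublist.length-mono-≤ P⊆Q-filters) filters-≢
    where
    P⊆Q-filters : Sublist._⊆_ (filter P? xs) (filter Q? xs)
    P⊆Q-filters = Sublist.filter⁺ P? Q? (λ { refl → P⊆Q }) (Sublist.⊆-refl {x = xs})

    filters-≢ : length (filter P? xs) ≢ length (filter Q? xs)
    filters-≢ eq = ¬py (proj₂ (∈-filter⁻ P? {xs = xs} y∈filter-P))
      where
      y∈filter-P : y ∈ filter P? xs
      y∈filter-P = subst (y ∈_) (sym (≋⇒≡ (Sublist.to-≋ eq P⊆Q-filters))) (∈-filter⁺ Q? y∈xs qy)

module _ {a p q} {A : Set a} {P : Pred A p} {Q : Pred A q}
         (P? : Decidable P) (Q? : Decidable Q) where

  length-filter-≤-suc : ∀ {xs z} → Unique xs → (∀ {x} → Q x → P x ⊎ x ≡ z) →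
                        length (filter Q? xs) ≤ suc (length (filter P? xs))
  length-filter-≤-suc [] _ = z≤n
  length-filter-≤-suc {x ∷ xs} (x∉xs ∷ u) Q⊆P∪z with Q? x | P? x
  ... | no  _  | no  _  = length-filter-≤-suc u Q⊆P∪z
  ... | no  _  | yes _  = ℕP.m≤n⇒m≤1+n (length-filter-≤-suc u Q⊆P∪z)
  ... | yes _  | yes _  = s≤s (length-filter-≤-suc u Q⊆P∪z)
  ... | yes qx | no ¬px with Q⊆P∪z qx
  ...   | inj₁ px   = contradiction px ¬px
  ...   | inj₂ refl = s≤s (length-filter-mono Q? P? xs (All.map Q⇒P x∉xs))
    where
    Q⇒P : ∀ {y} → x ≢ y → Q y → P y
    Q⇒P x≢y qy with Q⊆P∪z qy
    ... | inj₁ py   = py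
    ... | inj₂ refl = contradiction refl x≢y

module _ {n m k : ℕ} (J : TAP-AM n m k) where
  open TAP-AM J

  Fits : Assignment J → Fin n → Fin m → Set
  Fits M a s = Under J M s (subj₁ a) × Under J M s (subj₂ a)

  Fits⇒Under : ∀ {M a s p} → Fits M a s → HasSubj J a p → Under J M s p
  Fits⇒Under (u₁ , _) (inj₁ refl) = u₁
  Fits⇒Under (_ , u₂) (inj₂ refl) = u₂

  Room : Assignment J → Fin m → Fin k → Fin n → Set
  Room M s p a = Under J M s p ⊎ ∃[ b ] (InMp J M s p b × PrefersS J a b)

  SameType⇒HasSubj : ∀ {a b} → SameType J a b → HasSubj J b (subj₁ a) × HasSubj J b (subj₂ a)
  SameType⇒HasSubj (inj₁ (eq₁ , eq₂)) = inj₁ (sym eq₁) , inj₂ (sym eq₂)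
  SameType⇒HasSubj (inj₂ (eq₁ , eq₂)) = inj₂ (sym eq₂) , inj₁ (sym eq₁)

  HasSubj⇒SameType : ∀ {a b} → HasSubj J b (subj₁ a) → HasSubj J b (subj₂ a) → SameType J a b
  HasSubj⇒SameType (inj₁ eq₁) (inj₂ eq₂) = inj₁ (sym eq₁ , sym eq₂)
  HasSubj⇒SameType (inj₂ eq₁) (inj₁ eq₂) = inj₂ (sym eq₂ , sym eq₁)
  HasSubj⇒SameType {a} (inj₁ eq₁) (inj₁ eq₂) = contradiction (trans eq₁ (sym eq₂)) (distinct a)
  HasSubj⇒SameType {a} (inj₂ eq₁) (inj₂ eq₂) = contradiction (trans eq₁ (sym eq₂)) (distinct a)

  Blocks⇒Room : ∀ {M a s} → Blocks J M a s → Room M s (subj₁ a) a × Room M s (subj₂ a) a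
  Blocks⇒Room (_ , _ , inj₁ (u₁ , u₂)) = inj₁ u₁ , inj₁ u₂
  Blocks⇒Room (_ , _ , inj₂ (inj₁ (u₁ , worse))) = inj₁ u₁ , inj₂ worse
  Blocks⇒Room (_ , _ , inj₂ (inj₂ (inj₁ (u₂ , worse)))) = inj₂ worse , inj₁ u₂
  Blocks⇒Room (_ , _ , inj₂ (inj₂ (inj₂ (inj₁ (b , Mb≡s , same , a<b))))) =
    let h₁ , h₂ = SameType⇒HasSubj same
    in inj₂ (b , (Mb≡s , h₁) , a<b) , inj₂ (b , (Mb≡s , h₂) , a<b)
  Blocks⇒Room (_ , _ , inj₂ (inj₂ (inj₂ (inj₂ (b₁ , b₂ , _ , in₁ , in₂ , a<b₁ , a<b₂))))) =
    inj₂ (b₁ , in₁ , a<b₁) , inj₂ (b₂ , in₂ , a<b₂)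

  Room⇒Blocks : ∀ {M a s} → s ∈ pref a → Improves J M a s →
                Room M s (subj₁ a) a → Room M s (subj₂ a) a → Blocks J M a s
  Room⇒Blocks s∈ imp (inj₁ u₁) (inj₁ u₂) = s∈ , imp , inj₁ (u₁ , u₂)
  Room⇒Blocks s∈ imp (inj₁ u₁) (inj₂ worse) = s∈ , imp , inj₂ (inj₁ (u₁ , worse))
  Room⇒Blocks s∈ imp (inj₂ worse) (inj₁ u₂) = s∈ , imp , inj₂ (inj₂ (inj₁ (u₂ , worse)))
  Room⇒Blocks s∈ imp (inj₂ (b₁ , in₁ , a<b₁)) (inj₂ (b₂ , in₂ , a<b₂)) with b₁ ≟ b₂
  ... | no b₁≢b₂ =
    s∈ , imp , inj₂ (inj₂ (inj₂ (inj₂ (b₁ , b₂ , b₁≢b₂ , in₁ , in₂ , a<b₁ , a<b₂))))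
  ... | yes refl =
    let same = HasSubj⇒SameType (proj₂ in₁) (proj₂ in₂)
    in s∈ , imp , inj₂ (inj₂ (inj₂ (inj₁ (b₁ , proj₁ in₁ , same , a<b₁))))

  Improves⇒≢ : ∀ {M a s} → Improves J M a s → M a ≢ just s
  Improves⇒≢ (inj₁ Ma≡nothing) Ma≡s with () ← trans (sym Ma≡nothing) Ma≡s
  Improves⇒≢ {a = a} (inj₂ (s′ , Ma≡s′ , s-before-s′)) Ma≡s =
    Before⇒≢ (prefUnique a) s-before-s′ (just-injective (trans (sym Ma≡s) Ma≡s′))

  size-mono : ∀ {M M′ s p} → InMp J M s p ⊆ InMp J M′ s p → size J M s p ≤ size J M′ s p
  size-mono {M} {M′} {s} {p} sub =
    length-filter-mono (inMp? J M s p) (inMp? J M′ s p) (allFin n) (All.tabulate (λ _ → sub))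

  size-< : ∀ {M M′ s p b} → InMp J M s p ⊆ InMp J M′ s p →
           InMp J M′ s p b → ¬ InMp J M s p b → size J M s p < size J M′ s p
  size-< {M} {M′} {s} {p} {b} sub =
    length-filter-< (inMp? J M s p) (inMp? J M′ s p) sub (∈-allFin b)

  size-cong : ∀ {M M′} → M ≗ M′ → ∀ s p → size J M s p ≡ size J M′ s p
  size-cong {M} {M′} M≗M′ s p =
    cong length (filter-≐ (inMp? J M s p) (inMp? J M′ s p) (to M≗M′ , to (sym ∘ M≗M′)) (allFin n))
    where
    to : ∀ {M M′} → M ≗ M′ → InMp J M s p ⊆ InMp J M′ s p
    to M≗M′ {b} (Mb≡s , h) = trans (sym (M≗M′ b)) Mb≡s , h

  fits-cong : ∀ {M M′ a} → M ≗ M′ → Fits M a ⊆ Fits M′ a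
  fits-cong {a = a} M≗M′ {s} (u₁ , u₂) =
    subst (_< cap s (subj₁ a)) (size-cong M≗M′ s (subj₁ a)) u₁ ,
    subst (_< cap s (subj₂ a)) (size-cong M≗M′ s (subj₂ a)) u₂

  find-fits-cong : ∀ {M M′ a} → M ≗ M′ → ∀ ss → find (fits? J M a) ss ≡ find (fits? J M′ a) ss
  find-fits-cong M≗M′ =
    find-cong (fits? J _ _) (fits? J _ _) (fits-cong M≗M′ , fits-cong (sym ∘ M≗M′))

  _↾_ : Assignment J → ℕ → Assignment J
  (M ↾ c) b with toℕ b ℕ.<? c
  ... | yes _ = M b
  ... | no  _ = nothing

  ↾-< : ∀ {M c b} → toℕ b < c → (M ↾ c) b ≡ M b
  ↾-< {c = c} {b} b<c with toℕ b ℕ.<? c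
  ... | yes _   = refl
  ... | no  b≮c = contradiction b<c b≮c

  ↾-just : ∀ {M c b s} → (M ↾ c) b ≡ just s → toℕ b < c × M b ≡ just s
  ↾-just {c = c} {b} Mb≡s with toℕ b ℕ.<? c
  ... | yes b<c = b<c , Mb≡s

  ↾-cong : ∀ {M M′ c} → (∀ b → toℕ b < c → M b ≡ M′ b) → M ↾ c ≗ M′ ↾ c
  ↾-cong {c = c} agree b with toℕ b ℕ.<? c
  ... | yes b<c = agree b b<c
  ... | no  _   = refl

  InMp-↾⁺ : ∀ {M c s p b} → toℕ b < c → InMp J M s p b → InMp J (M ↾ c) s p b
  InMp-↾⁺ b<c (Mb≡s , h) = trans (↾-< b<c) Mb≡s , h

  InMp-↾⁻ : ∀ M c {s p b} → InMp J (M ↾ c) s p b → toℕ b < c × InMp J M s p b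
  InMp-↾⁻ M c (Mb≡s , h) = let b<c , Mb≡s′ = ↾-just Mb≡s in b<c , (Mb≡s′ , h)

  InMp-↾-suc⁻ : ∀ {M c s p b} → InMp J (M ↾ suc c) s p b →
                InMp J (M ↾ c) s p b ⊎ (toℕ b ≡ c × InMp J M s p b)
  InMp-↾-suc⁻ {M} {c} occ with InMp-↾⁻ M (suc c) occ
  ... | b<1+c , occ′ with ℕP.m<1+n⇒m<n∨m≡n b<1+c
  ...   | inj₁ b<c = inj₁ (InMp-↾⁺ b<c occ′)
  ...   | inj₂ b≡c = inj₂ (b≡c , occ′)

  occupant-below : ∀ {M c s p b} → size J M s p ≤ cap s p →
                   ¬ Under J (M ↾ c) s p → InMp J M s p b → toℕ b < c
  occupant-below {M} {c} {s} {p} {b} within full occ with toℕ b ℕ.<? c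
  ... | yes b<c = b<c
  ... | no  b≮c = contradiction (ℕP.<-≤-trans fewer-below within) full
    where
    fewer-below : size J (M ↾ c) s p < size J M s p
    fewer-below = size-< (proj₂ ∘ InMp-↾⁻ M c) occ (b≮c ∘ proj₁ ∘ InMp-↾⁻ M c)

  assigned⇒under-below : ∀ {M s p a} → size J M s p ≤ cap s p →
                         InMp J M s p a → Under J (M ↾ toℕ a) s p
  assigned⇒under-below {M} {s} {p} {a} within occ with size J (M ↾ toℕ a) s p ℕ.<? cap s p
  ... | yes under = under
  ... | no  full  = contradiction (occupant-below within full occ) (ℕP.<-irrefl refl)

  room⇒under-below : ∀ {M s p a} → size J M s p ≤ cap s p →
                     Room M s p a → Under J (M ↾ toℕ a) s p
  room⇒under-below {M} {s} {p} {a} within room with size J (M ↾ toℕ a) s p ℕ.<? cap s p | room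
  ... | yes under | _ = under
  ... | no  full  | inj₁ under =
    contradiction (ℕP.≤-<-trans (size-mono (proj₂ ∘ InMp-↾⁻ M (toℕ a))) under) full
  ... | no  full  | inj₂ (b , occ , a<b) =
    contradiction (occupant-below within full occ) (ℕP.<-asym a<b)

  under-below⇒room : ∀ {M s p a} → M a ≢ just s → Under J (M ↾ toℕ a) s p → Room M s p a
  under-below⇒room {M} {s} {p} {a} Ma≢s under
    with FinP.any? (λ b → inMp? J M s p b ×-dec (toℕ a ℕ.<? toℕ b))
  ... | yes worse    = inj₂ worse
  ... | no  ¬worse   = inj₁ (ℕP.≤-<-trans (size-mono occupant⇒below) under)
    where
    occupant⇒below : InMp J M s p ⊆ InMp J (M ↾ toℕ a) s p
    occupant⇒below {b} occ with ℕP.<-cmp (toℕ b) (toℕ a)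
    ... | tri< b<a _ _ = InMp-↾⁺ b<a occ
    ... | tri≈ _ b≡a _ rewrite FinP.toℕ-injective b≡a = contradiction (proj₁ occ) Ma≢s
    ... | tri> _ _ a<b = contradiction (b , occ , a<b) ¬worse

  Greedy : Assignment J → Set
  Greedy M = ∀ a → M a ≡ find (fits? J (M ↾ toℕ a) a) (pref a)

  greedy⇒Fits-below : ∀ {M a s} → Greedy M → M a ≡ just s → Fits (M ↾ toℕ a) a s
  greedy⇒Fits-below {a = a} greedy Ma≡s =
    find-just⇒P (fits? J _ a) {xs = pref a} (trans (sym (greedy a)) Ma≡s)

  greedy-size-↾ : ∀ {M} → Greedy M → ∀ c s p → size J (M ↾ c) s p ≤ cap s p
  greedy-size-↾ {M} greedy zero s p = ℕP.≤-trans (ℕP.≤-reflexive nobody) z≤n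
    where
    nobody : size J (M ↾ 0) s p ≡ 0
    nobody = cong length (filter-none (inMp? J (M ↾ 0) s p) {xs = allFin n}
                            (All.tabulate (λ _ → ℕP.n≮0 ∘ proj₁ ∘ InMp-↾⁻ M 0)))
  greedy-size-↾ {M} greedy (suc c) s p
    with FinP.any? (λ b → (toℕ b ℕ.≟ c) ×-dec inMp? J M s p b)
  ... | yes (b , refl , occ) = ℕP.≤-trans
          (length-filter-≤-suc (inMp? J (M ↾ toℕ b) s p) (inMp? J (M ↾ suc c) s p)
             (allFin⁺ n) (map₂ (FinP.toℕ-injective ∘ proj₁) ∘ InMp-↾-suc⁻))
          (Fits⇒Under (greedy⇒Fits-below greedy (proj₁ occ)) (proj₂ occ))
  ... | no  ¬occ = ℕP.≤-trans (size-mono later-absent) (greedy-size-↾ greedy c s p)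
    where
    later-absent : InMp J (M ↾ suc c) s p ⊆ InMp J (M ↾ c) s p
    later-absent occ with InMp-↾-suc⁻ occ
    ... | inj₁ occ′         = occ′
    ... | inj₂ (b≡c , occ′) = contradiction (_ , b≡c , occ′) ¬occ

  greedy⇒IsMatching : ∀ {M} → Greedy M → IsMatching J M
  greedy⇒IsMatching {M} greedy = acceptable , within
    where
    acceptable : ∀ a s → M a ≡ just s → s ∈ pref a
    acceptable a s Ma≡s = find-just⇒∈ (fits? J _ a) (trans (sym (greedy a)) Ma≡s)

    within : ∀ s p → size J M s p ≤ cap s p
    within s p = ℕP.≤-trans (size-mono (InMp-↾⁺ (FinP.toℕ<n _))) (greedy-size-↾ greedy n s p)

  greedy⇒¬Fits-improving : ∀ {M a s} → Greedy M → s ∈ pref a → Improves J M a s →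
                           ¬ Fits (M ↾ toℕ a) a s
  greedy⇒¬Fits-improving {a = a} greedy s∈ (inj₁ Ma≡nothing) =
    find-nothing⇒¬P (fits? J _ a) (trans (sym (greedy a)) Ma≡nothing) s∈
  greedy⇒¬Fits-improving {a = a} greedy _ (inj₂ (_ , Ma≡s′ , s-before-s′)) =
    find-just⇒¬P-before (fits? J _ a) (prefUnique a) (trans (sym (greedy a)) Ma≡s′) s-before-s′

  greedy⇒IsStable : ∀ {M} → Greedy M → IsStable J M
  greedy⇒IsStable {M} greedy = matching , ¬blocks
    where
    matching : IsMatching J M
    matching = greedy⇒IsMatching greedy

    ¬blocks : ∀ a s → ¬ Blocks J M a s
    ¬blocks a s blocks@(s∈ , improves , _) =
      let room₁ , room₂ = Blocks⇒Room blocks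
      in greedy⇒¬Fits-improving greedy s∈ improves
           (room⇒under-below (proj₂ matching s _) room₁ , room⇒under-below (proj₂ matching s _) room₂)

  assigned⇒Fits-below : ∀ {M a s} → (∀ p → size J M s p ≤ cap s p) →
                        M a ≡ just s → Fits (M ↾ toℕ a) a s
  assigned⇒Fits-below within Ma≡s =
    assigned⇒under-below (within _) (Ma≡s , inj₁ refl) ,
    assigned⇒under-below (within _) (Ma≡s , inj₂ refl)

  found⇒Blocks : ∀ {M a t} → find (fits? J (M ↾ toℕ a) a) (pref a) ≡ just t →
                 Improves J M a t → Blocks J M a t
  found⇒Blocks {M} {a} {t} found improves =
    Room⇒Blocks (find-just⇒∈ (fits? J _ a) found) improves (room (proj₁ fits)) (room (proj₂ fits))
    where
    fits : Fits (M ↾ toℕ a) a t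
    fits = find-just⇒P (fits? J _ a) {xs = pref a} found

    room : ∀ {p} → Under J (M ↾ toℕ a) t p → Room M t p a
    room = under-below⇒room {M} {t} {_} {a} (Improves⇒≢ {M} improves)

  IsStable⇒Greedy : ∀ {M} → IsStable J M → Greedy M
  IsStable⇒Greedy {M} ((acceptable , within) , ¬blocks) a with M a in Ma≡
  ... | nothing with find (fits? J (M ↾ toℕ a) a) (pref a) in found
  ...   | nothing = refl
  ...   | just s  = ⊥-elim (¬blocks a s (found⇒Blocks found (inj₁ Ma≡)))
  IsStable⇒Greedy {M} ((acceptable , within) , ¬blocks) a | just s′
    with find-first (fits? J (M ↾ toℕ a) a) (acceptable a s′ Ma≡) (assigned⇒Fits-below (within s′) Ma≡)
  ... | _ , found , inj₁ refl     = sym found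
  ... | t , found , inj₂ t-before =
    ⊥-elim (¬blocks a t (found⇒Blocks found (inj₂ (s′ , Ma≡ , t-before))))

  greedy-unique : ∀ {M M′} → Greedy M → Greedy M′ → M ≗ M′
  greedy-unique {M} {M′} greedy greedy′ b = agree-below (suc (toℕ b)) b ℕP.≤-refl
    where
    agree-below : ∀ c b → toℕ b < c → M b ≡ M′ b
    agree-below (suc c) b b<1+c = begin
      M b                                              ≡⟨ greedy b ⟩
      find (fits? J (M ↾ toℕ b) b) (pref b)            ≡⟨ find-fits-cong (↾-cong earlier-agree) (pref b) ⟩
      find (fits? J (M′ ↾ toℕ b) b) (pref b)           ≡⟨ sym (greedy′ b) ⟩
      M′ b                                             ∎
      where
      open ≡-Reasoning
      earlier-agree : ∀ b′ → toℕ b′ < toℕ b → M b′ ≡ M′ b′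
      earlier-agree b′ b′<b = agree-below c b′ (ℕP.<-≤-trans b′<b (ℕP.m<1+n⇒m≤n b<1+c))

  firstFit≡find : ∀ M a ss → firstFit J M a ss ≡ find (fits? J M a) ss
  firstFit≡find M a []       = refl
  firstFit≡find M a (s ∷ ss) =
    cong₂ (λ fits rest → if fits then just s else rest)
          (isYes≗does (fits? J M a s)) (firstFit≡find M a ss)

  step-self : ∀ M x → step J M x x ≡ firstFit J M x (pref x)
  step-self M x with x ≟ x
  ... | yes _   = refl
  ... | no  x≢x = contradiction refl x≢x

  step-other : ∀ M {x b} → b ≢ x → step J M x b ≡ M b
  step-other M {x} {b} b≢x with b ≟ x
  ... | yes b≡x = contradiction b≡x b≢x
  ... | no  _   = refl

  foldl-step-∉ : ∀ M xs {b} → b ∉ xs → foldl (step J) M xs b ≡ M b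
  foldl-step-∉ M []       b∉ = refl
  foldl-step-∉ M (x ∷ xs) b∉ =
    trans (foldl-step-∉ (step J M x) xs (b∉ ∘ there)) (step-other M (b∉ ∘ here))

  foldl-step-greedy : ∀ M xs → AllPairs Fin._<_ xs →
                      All (λ y → ∀ b → y Fin.≤ b → M b ≡ nothing) xs →
                      ∀ {a} → a ∈ xs →
                      foldl (step J) M xs a ≡ find (fits? J (foldl (step J) M xs ↾ toℕ a) a) (pref a)
  foldl-step-greedy M (x ∷ xs) (x<xs ∷ _) (empty-from-x ∷ _) (here refl) = begin
    F x                                   ≡⟨ foldl-step-∉ M₁ xs x∉xs ⟩
    step J M x x                          ≡⟨ step-self M x ⟩
    firstFit J M x (pref x)               ≡⟨ firstFit≡find M x (pref x) ⟩
    find (fits? J M x) (pref x)           ≡⟨ find-fits-cong M≗F↾x (pref x) ⟩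
    find (fits? J (F ↾ toℕ x) x) (pref x) ∎
    where
    open ≡-Reasoning
    M₁ F : Assignment J
    M₁ = step J M x
    F  = foldl (step J) M₁ xs

    x∉xs : x ∉ xs
    x∉xs x∈xs = ℕP.<-irrefl refl (All.lookup x<xs x∈xs)

    M≗F↾x : M ≗ F ↾ toℕ x
    M≗F↾x b with toℕ b ℕ.<? toℕ x
    ... | yes b<x = sym (begin
      F b  ≡⟨ foldl-step-∉ M₁ xs (λ b∈xs → ℕP.<-asym b<x (All.lookup x<xs b∈xs)) ⟩
      M₁ b ≡⟨ step-other M (λ { refl → ℕP.<-irrefl refl b<x }) ⟩
      M b  ∎)
    ... | no  b≮x = empty-from-x b (ℕP.≮⇒≥ b≮x)
  foldl-step-greedy M (x ∷ xs) (x<xs ∷ sorted) (_ ∷ empty-from) (there a∈xs) =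
    foldl-step-greedy (step J M x) xs sorted (All.zipWith still-empty (x<xs , empty-from)) a∈xs
    where
    still-empty : ∀ {y} → x Fin.< y × (∀ b → y Fin.≤ b → M b ≡ nothing) →
                  ∀ b → y Fin.≤ b → step J M x b ≡ nothing
    still-empty (x<y , empty-from-y) b y≤b =
      trans (step-other M (λ { refl → ℕP.<-irrefl refl (ℕP.<-≤-trans x<y y≤b) }))
            (empty-from-y b y≤b)

  serialDictatorship-greedy : Greedy (serialDictatorship J)
  serialDictatorship-greedy a =
    foldl-step-greedy (λ _ → nothing) (allFin n) (tabulate⁺-< (λ i<j → i<j))
                      (All.tabulate (λ _ _ _ → refl)) (∈-allFin a)

theorem2 : ∀ {n m k : ℕ} (J : TAP-AM n m k) →
    IsStable J (serialDictatorship J)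
    × (∀ (M : Assignment J) → IsStable J M → ∀ a → M a ≡ serialDictatorship J a)
theorem2 J =
  greedy⇒IsStable J (serialDictatorship-greedy J) ,
  λ M stable → greedy-unique J (IsStable⇒Greedy J stable) (serialDictatorship-greedy J)
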